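{- Let $X = \langle x_1,\ldots,x_n\rangle$ and $Y = \langle y_1,\ldots,y_m\rangle$ be sequences over an alphabet $\Sigma$, and let $P = \langle p_1,\ldots,p_r\rangle$ be a common subsequence of $X$ and $Y$. Consider the constrained sequence alignment (CSA) problem for $X$, $Y$, $P$ with the distance function $\delta$ on $\Sigma \cup \{\texttt{ - }\}$ given by $\delta(x',y') = -1$ if $x' = y'$ and $\delta(x',y') = 0$ if $x' \neq y'$. Then the CLCS problem for $X$ and $Y$ with respect to $P$ is equivalent to this CSA problem, in the following sense: for every optimal (minimum-score) constrained alignment $\left[{X' \atop Y'}\right]$, the sequence $Z'$ formed by the characters of the columns $i$ with $x'_i = y'_i$ (in order) is a constrained longest common subsequence of $X$ and $Y$ with respect to $P$; and conversely, for every constrained longest common subsequence $Z$ of $X$ and $Y$ with respect to $P$, of length $\ell$, inserting spaces into $X$ and $Y$ so that each character of $Z$ occupies a common column yields an optimal constrained alignment, whose score is $-\ell$.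
   Context: A subsequence of a sequence $X$ is obtained by deleting some (not necessarily contiguous) characters; a common subsequence of $X$ and $Y$ is a subsequence of both. A constrained longest common subsequence (CLCS) of $X$ and $Y$ with respect to $P$ is a longest common subsequence $Z$ of $X$ and $Y$ such that $P$ is a subsequence of $Z$. An alignment of $X$ (length $n$) and $Y$ (length $m$) is a pair of sequences $X' = \langle x'_1,\ldots,x'_{n'}\rangle$, $Y' = \langle y'_1,\ldots,y'_{n'}\rangle$ over $\Sigma \cup \{\texttt{ - }\}$ (where $\texttt{ - }\notin\Sigma$ is the space character) of equal length $n' \ge n, m$ such that removing all spaces from $X'$ and $Y'$ gives $X$ and $Y$ respectively, and there is no $i$ with $x'_i = y'_i = \texttt{ - }$. Its score under a distance function $\delta : (\Sigma\cup\{\texttt{ - }\})^2 \to \mathbb{R}$ is $\sum_{i=1}^{n'} \delta(x'_i, y'_i)$. Given a constrained sequence $P = \langle p_1,\ldots,p_r\rangle$ that is a common subsequence of $X$ and $Y$, a constrained alignment is an alignment for which there exist indices $1 \le c_1 < c_2 < \cdots < c_r \le n'$ with $x'_{c_k} = y'_{c_k} = p_k$ for all $1 \le k \le r$. The CSA problem asks for a constrained alignment of minimum score. -}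

module Defs where

open import Data.List using (List; []; _∷_; map; catMaybes; length)
open import Data.List.Relation.Unary.All using (All)
open import Data.List.Relation.Binary.Sublist.Propositional using (_⊆_)
open import Data.Maybe using (Maybe; just; nothing)
open import Data.Maybe.Properties using (≡-dec)
open import Data.Nat as ℕ using ()
open import Data.Integer using (ℤ; +_; -[1+_]; _+_) renaming (_≤_ to _≤ℤ_)
open import Data.Product using (_×_; _,_; proj₁; proj₂)
open import Relation.Binary.Definitions using (DecidableEquality)
open import Relation.Binary.PropositionalEquality using (_≡_)
open import Relation.Nullary using (¬_; yes; no)

-- A column of an alignment: nothing plays the role of the space character '-'.
Column : Set → Set
Column A = Maybe A × Maybe A

record Alignment {A : Set} (X Y : List A) : Set where
  constructor mkAlignment
  field
    cols    : List (Column A)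
    noGapGap : All (λ c → ¬ (proj₁ c ≡ nothing × proj₂ c ≡ nothing)) cols
    topRow  : catMaybes (map proj₁ cols) ≡ X
    botRow  : catMaybes (map proj₂ cols) ≡ Y
open Alignment public

diag : {A : Set} → A → Column A
diag a = just a , just a

-- Constrained alignment: there are increasing column indices c_1 < ... < c_r
-- with x'_{c_k} = y'_{c_k} = p_k, i.e. the list of columns (p_k,p_k) is a
-- subsequence of the columns.
IsConstrained : {A : Set} {X Y : List A} → List A → Alignment X Y → Set
IsConstrained P al = map diag P ⊆ cols al

δ : {A : Set} → DecidableEquality A → Maybe A → Maybe A → ℤ
δ _≟_ x y with ≡-dec _≟_ x y
... | yes _ = -[1+ 0 ]
... | no  _ = + 0

scoreCols : {A : Set} → DecidableEquality A → List (Column A) → ℤ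
scoreCols _≟_ [] = + 0
scoreCols _≟_ ((x , y) ∷ cs) = δ _≟_ x y + scoreCols _≟_ cs

score : {A : Set} → DecidableEquality A → {X Y : List A} → Alignment X Y → ℤ
score _≟_ al = scoreCols _≟_ (cols al)

IsOptimalConstrained : {A : Set} → DecidableEquality A → {X Y : List A} →
                       List A → Alignment X Y → Set
IsOptimalConstrained _≟_ {X} {Y} P al =
  IsConstrained P al ×
  ((al′ : Alignment X Y) → IsConstrained P al′ → score _≟_ al ≤ℤ score _≟_ al′)

matchedChars : {A : Set} → DecidableEquality A → List (Column A) → List A
matchedChars _≟_ [] = []
matchedChars _≟_ ((just a , just b) ∷ cs) with a ≟ b
... | yes _ = a ∷ matchedChars _≟_ cs
... | no  _ = matchedChars _≟_ cs
matchedChars _≟_ ((nothing , _) ∷ cs) = matchedChars _≟_ cs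
matchedChars _≟_ ((just _ , nothing) ∷ cs) = matchedChars _≟_ cs

CommonSubseq : {A : Set} → List A → List A → List A → Set
CommonSubseq X Y Z = Z ⊆ X × Z ⊆ Y

IsCLCS : {A : Set} → List A → List A → List A → List A → Set
IsCLCS {A} X Y P Z =
  CommonSubseq X Y Z × P ⊆ Z ×
  ((W : List A) → CommonSubseq X Y W → P ⊆ W → length W ℕ.≤ length Z)

-- Under δ, a column scores -1 exactly when its two entries are equal characters
-- (the column (-,-) never occurs), so the score of an alignment is minus the
-- length of its matched sequence Z'.  That sequence is a common subsequence of X
-- and Y, and it contains every Z whose diagonal columns (z,z) occur in order; in
-- particular it contains P when the alignment is constrained.  Conversely every
-- common subsequence Z can be laid out as the diagonal columns of an alignment.
-- Minimising the score over constrained alignments is therefore maximising the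
-- length of a common subsequence containing P.
module Submission where

open import Defs
open import Data.Empty using (⊥-elim)
open import Data.Integer using (-_; +_; -[1+_]; _+_; +≤+) renaming (_≤_ to _≤ℤ_)
open import Data.Integer.Properties using (+-identityˡ; neg-mono-≤; neg-cancel-≤; drop‿+≤+)
open import Data.List using (List; []; _∷_; map; length; catMaybes)
open import Data.List.Relation.Binary.Sublist.Propositional using (_⊆_; []; _∷_; _∷ʳ_; ⊆-trans)
open import Data.List.Relation.Binary.Sublist.Propositional.Properties using (map⁺; length-mono-≤)
open import Data.List.Relation.Unary.All using (All; []; _∷_)
open import Data.Maybe using (just; nothing)
open import Data.Maybe.Properties using (≡-dec)
open import Data.Nat as ℕ using (ℕ; zero; suc)
open import Data.Nat.Properties using (≤-antisym; ≤-trans)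
open import Data.Product as Σ using (_×_; Σ; _,_; proj₁; proj₂)
open import Relation.Binary.Definitions using (DecidableEquality)
open import Relation.Binary.PropositionalEquality
  using (_≡_; refl; sym; trans; cong; subst; subst₂; module ≡-Reasoning)
open import Relation.Nullary using (¬_; yes; no)

-1+-n≡-[1+n] : ∀ n → -[1+ 0 ] + - (+ n) ≡ - (+ suc n)
-1+-n≡-[1+n] zero    = refl
-1+-n≡-[1+n] (suc n) = refl

module _ {A : Set} {X Y : List A} where

  gap-below : (x : A) → Alignment X Y → Alignment (x ∷ X) Y
  gap-below x (mkAlignment cs ng t b) =
    mkAlignment ((just x , nothing) ∷ cs) ((λ { (() , _) }) ∷ ng) (cong (x ∷_) t) b

  gap-above : (y : A) → Alignment X Y → Alignment X (y ∷ Y)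
  gap-above y (mkAlignment cs ng t b) =
    mkAlignment ((nothing , just y) ∷ cs) ((λ { (_ , ()) }) ∷ ng) t (cong (y ∷_) b)

  match : (a : A) → Alignment X Y → Alignment (a ∷ X) (a ∷ Y)
  match a (mkAlignment cs ng t b) =
    mkAlignment (diag a ∷ cs) ((λ { (() , _) }) ∷ ng) (cong (a ∷_) t) (cong (a ∷_) b)

alignAlong : {A : Set} {Z X Y : List A} → Z ⊆ X → Z ⊆ Y →
             Σ (Alignment X Y) (λ al → map diag Z ⊆ cols al)
alignAlong []         []         = mkAlignment [] [] refl refl , []
alignAlong (x ∷ʳ p)   q          = Σ.map (gap-below x) (_ ∷ʳ_) (alignAlong p q)
alignAlong []         (y ∷ʳ q)   = Σ.map (gap-above y) (_ ∷ʳ_) (alignAlong [] q)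
alignAlong (refl ∷ p) (y ∷ʳ q)   = Σ.map (gap-above y) (_ ∷ʳ_) (alignAlong (refl ∷ p) q)
alignAlong (refl ∷ p) (refl ∷ q) = Σ.map (match _) (refl ∷_) (alignAlong p q)

module _ {A : Set} (_≟_ : DecidableEquality A) where

  matchedChars-⊆-top : (cs : List (Column A)) →
                       matchedChars _≟_ cs ⊆ catMaybes (map proj₁ cs)
  matchedChars-⊆-top []                        = []
  matchedChars-⊆-top ((nothing , _) ∷ cs)      = matchedChars-⊆-top cs
  matchedChars-⊆-top ((just a , nothing) ∷ cs) = a ∷ʳ matchedChars-⊆-top cs
  matchedChars-⊆-top ((just a , just b) ∷ cs) with a ≟ b
  ... | yes _ = refl ∷ matchedChars-⊆-top cs
  ... | no  _ = a ∷ʳ matchedChars-⊆-top cs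

  matchedChars-⊆-bot : (cs : List (Column A)) →
                       matchedChars _≟_ cs ⊆ catMaybes (map proj₂ cs)
  matchedChars-⊆-bot []                          = []
  matchedChars-⊆-bot ((nothing , nothing) ∷ cs)  = matchedChars-⊆-bot cs
  matchedChars-⊆-bot ((nothing , just b) ∷ cs)   = b ∷ʳ matchedChars-⊆-bot cs
  matchedChars-⊆-bot ((just a , nothing) ∷ cs)   = matchedChars-⊆-bot cs
  matchedChars-⊆-bot ((just a , just b) ∷ cs) with a ≟ b
  ... | yes refl = refl ∷ matchedChars-⊆-bot cs
  ... | no  _    = b ∷ʳ matchedChars-⊆-bot cs

  matchedChars-common : {X Y : List A} (al : Alignment X Y) →
                        CommonSubseq X Y (matchedChars _≟_ (cols al))
  matchedChars-common al =
    subst (_ ⊆_) (topRow al) (matchedChars-⊆-top (cols al)) ,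
    subst (_ ⊆_) (botRow al) (matchedChars-⊆-bot (cols al))

  diag-⊆⇒⊆-matchedChars : (Z : List A) (cs : List (Column A)) →
                          map diag Z ⊆ cs → Z ⊆ matchedChars _≟_ cs
  diag-⊆⇒⊆-matchedChars [] [] [] = []
  diag-⊆⇒⊆-matchedChars Z ((nothing , _) ∷ cs) (_ ∷ʳ p) = diag-⊆⇒⊆-matchedChars Z cs p
  diag-⊆⇒⊆-matchedChars Z ((just a , nothing) ∷ cs) (_ ∷ʳ p) = diag-⊆⇒⊆-matchedChars Z cs p
  diag-⊆⇒⊆-matchedChars Z ((just a , just b) ∷ cs) (_ ∷ʳ p) with a ≟ b
  ... | yes _ = a ∷ʳ diag-⊆⇒⊆-matchedChars Z cs p
  ... | no  _ = diag-⊆⇒⊆-matchedChars Z cs p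
  diag-⊆⇒⊆-matchedChars (z ∷ Z) ((just a , just .a) ∷ cs) (refl ∷ p) with a ≟ a
  ... | yes _ = refl ∷ diag-⊆⇒⊆-matchedChars Z cs p
  ... | no a≢a = ⊥-elim (a≢a refl)

  -- The column (-,-) would score -1 without contributing to Z'; noGapGap excludes it.
  scoreCols≡-matched : (cs : List (Column A)) →
    All (λ c → ¬ (proj₁ c ≡ nothing × proj₂ c ≡ nothing)) cs →
    scoreCols _≟_ cs ≡ - (+ length (matchedChars _≟_ cs))
  scoreCols≡-matched [] [] = refl
  scoreCols≡-matched ((nothing , nothing) ∷ cs) (ng ∷ _) = ⊥-elim (ng (refl , refl))
  scoreCols≡-matched ((nothing , just b) ∷ cs) (_ ∷ ngs) =
    trans (+-identityˡ _) (scoreCols≡-matched cs ngs)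
  scoreCols≡-matched ((just a , nothing) ∷ cs) (_ ∷ ngs) =
    trans (+-identityˡ _) (scoreCols≡-matched cs ngs)
  scoreCols≡-matched ((just a , just b) ∷ cs) (_ ∷ ngs)
    with a ≟ b | ≡-dec _≟_ (just a) (just b)
  ... | yes _    | yes _   = begin
      -[1+ 0 ] + scoreCols _≟_ cs                       ≡⟨ cong (λ s → -[1+ 0 ] + s) (scoreCols≡-matched cs ngs) ⟩
      -[1+ 0 ] + - (+ length (matchedChars _≟_ cs))     ≡⟨ -1+-n≡-[1+n] _ ⟩
      - (+ suc (length (matchedChars _≟_ cs)))          ∎
    where open ≡-Reasoning
  ... | yes refl | no a≢a  = ⊥-elim (a≢a refl)
  ... | no a≢b   | yes refl = ⊥-elim (a≢b refl)
  ... | no _     | no _    = begin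
      + 0 + scoreCols _≟_ cs                            ≡⟨ +-identityˡ _ ⟩
      scoreCols _≟_ cs                                  ≡⟨ scoreCols≡-matched cs ngs ⟩
      - (+ length (matchedChars _≟_ cs))                ∎
    where open ≡-Reasoning

  matchCount : {X Y : List A} → Alignment X Y → ℕ
  matchCount al = length (matchedChars _≟_ (cols al))

  score≡-matchCount : {X Y : List A} (al : Alignment X Y) →
                      score _≟_ al ≡ - (+ matchCount al)
  score≡-matchCount al = scoreCols≡-matched (cols al) (noGapGap al)

  score-≤⇒matchCount-≥ : {X Y : List A} (al al′ : Alignment X Y) →
    score _≟_ al ≤ℤ score _≟_ al′ → matchCount al′ ℕ.≤ matchCount al
  score-≤⇒matchCount-≥ al al′ le =
    drop‿+≤+ (neg-cancel-≤ (subst₂ _≤ℤ_ (score≡-matchCount al) (score≡-matchCount al′) le))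

  matchCount-≥⇒score-≤ : {X Y : List A} (al al′ : Alignment X Y) →
    matchCount al′ ℕ.≤ matchCount al → score _≟_ al ≤ℤ score _≟_ al′
  matchCount-≥⇒score-≤ al al′ le =
    subst₂ _≤ℤ_ (sym (score≡-matchCount al)) (sym (score≡-matchCount al′)) (neg-mono-≤ (+≤+ le))

  constrained⇒P-⊆-matched : {P X Y : List A} (al : Alignment X Y) →
    IsConstrained P al → P ⊆ matchedChars _≟_ (cols al)
  constrained⇒P-⊆-matched al = diag-⊆⇒⊆-matchedChars _ (cols al)

  matchCount-≤-CLCS : {P X Y Z : List A} → IsCLCS X Y P Z →
    (al : Alignment X Y) → IsConstrained P al → matchCount al ℕ.≤ length Z
  matchCount-≤-CLCS (_ , _ , maximal) al c =
    maximal _ (matchedChars-common al) (constrained⇒P-⊆-matched al c)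

  optimal⇒CLCS : {P X Y : List A} (al : Alignment X Y) →
    IsOptimalConstrained _≟_ P al → IsCLCS X Y P (matchedChars _≟_ (cols al))
  optimal⇒CLCS {P} {X} {Y} al (c , optimal) =
    matchedChars-common al , constrained⇒P-⊆-matched al c , maximal
    where
    maximal : (W : List A) → CommonSubseq X Y W → P ⊆ W → length W ℕ.≤ matchCount al
    maximal W (W⊆X , W⊆Y) P⊆W with alignAlong W⊆X W⊆Y
    ... | al′ , W-diag = ≤-trans
      (length-mono-≤ (diag-⊆⇒⊆-matchedChars W (cols al′) W-diag))
      (score-≤⇒matchCount-≥ al al′ (optimal al′ (⊆-trans (map⁺ diag P⊆W) W-diag)))

  CLCS-aligned⇒optimal : {P X Y Z : List A} → IsCLCS X Y P Z →
    (al : Alignment X Y) → map diag Z ⊆ cols al →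
    IsOptimalConstrained _≟_ P al × score _≟_ al ≡ - (+ length Z)
  CLCS-aligned⇒optimal {P} {X} {Y} {Z} clcs@(_ , P⊆Z , _) al Z-diag =
    (constrained , optimal) , trans (score≡-matchCount al) (cong (λ n → - (+ n)) count≡)
    where
    constrained : IsConstrained P al
    constrained = ⊆-trans (map⁺ diag P⊆Z) Z-diag

    count≡ : matchCount al ≡ length Z
    count≡ = ≤-antisym (matchCount-≤-CLCS clcs al constrained)
                       (length-mono-≤ (diag-⊆⇒⊆-matchedChars Z (cols al) Z-diag))

    optimal : (al′ : Alignment X Y) → IsConstrained P al′ → score _≟_ al ≤ℤ score _≟_ al′
    optimal al′ c′ = matchCount-≥⇒score-≤ al al′
      (subst (matchCount al′ ℕ.≤_) (sym count≡) (matchCount-≤-CLCS clcs al′ c′))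

theorem3 : {A : Set} (_≟_ : DecidableEquality A) (X Y P : List A) →
    P ⊆ X → P ⊆ Y →
    ((al : Alignment X Y) → IsOptimalConstrained _≟_ P al →
       IsCLCS X Y P (matchedChars _≟_ (cols al)))
    ×
    ((Z : List A) → IsCLCS X Y P Z →
       Σ (Alignment X Y) (λ al → map diag Z ⊆ cols al)
       × ((al : Alignment X Y) → map diag Z ⊆ cols al →
            IsOptimalConstrained _≟_ P al × score _≟_ al ≡ - (+ (length Z))))
theorem3 _≟_ X Y P _ _ =
  optimal⇒CLCS _≟_ ,
  λ { Z clcs@((Z⊆X , Z⊆Y) , _) → alignAlong Z⊆X Z⊆Y , CLCS-aligned⇒optimal _≟_ clcs }
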